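{- Let $G=d_1d_2\ldots d_n$ be a \textsc{flipping coins} position. If $d_1d_2\ldots d_n$ contains a non-zero even number of $1$s, or if $d_1=1$ and there are at least two $1$s, then Left wins $G$ (that is, Left has a winning strategy whether she moves first or second; equivalently $G>0$).
   Context: \textsc{Flipping coins}: a position is a finite string $d_1d_2\ldots d_n$ with each $d_i\in\{0,1\}$ (written left to right). Any $0$s after the last $1$ are deleted, so a position is either empty or ends in $1$. A Left move chooses indices $i<j$ with $d_i=d_j=1$ and changes both to $0$. A Right move chooses indices $k<\ell$ with $d_k=0$ and $d_\ell=1$, and changes $d_k$ to $1$ and $d_\ell$ to $0$. After any move, all $0$s following the last $1$ are deleted. The game is played under normal play: a player unable to move loses. -}

module Defs where

open import Data.Bool using (Bool; true; false)
open import Data.Nat using (ℕ; zero; suc; _<_; _+_)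
open import Data.List using (List; []; _∷_; length)
open import Data.Product using (Σ; _×_; ∃; ∃-syntax; _,_)
open import Relation.Binary.PropositionalEquality using (_≡_)

-- A string d₁d₂…dₙ of coins, true = 1, false = 0, written left to right.
Coins : Set
Coins = List Bool

trim : Coins → Coins
trim [] = []
trim (b ∷ bs) with trim bs
... | [] with b
...    | true  = true ∷ []
...    | false = []
trim (b ∷ bs) | c ∷ cs = b ∷ c ∷ cs

-- A position: empty or ending in 1 (i.e. already trimmed).
IsPosition : Coins → Set
IsPosition d = trim d ≡ d

-- Coin at (0-based) index i; out of range reads as 0.
at : Coins → ℕ → Bool
at []       _       = false
at (b ∷ _)  zero    = b
at (_ ∷ bs) (suc i) = at bs i

set : Coins → ℕ → Bool → Coins
set []       _       _ = []
set (_ ∷ bs) zero    c = c ∷ bs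
set (b ∷ bs) (suc i) c = b ∷ set bs i c

ones : Coins → ℕ
ones [] = 0
ones (true ∷ bs)  = suc (ones bs)
ones (false ∷ bs) = ones bs

LeftMove : Coins → Coins → Set
LeftMove d d' = ∃[ i ] ∃[ j ] (i < j × j < length d × at d i ≡ true × at d j ≡ true
                 × d' ≡ trim (set (set d i false) j false))

RightMove : Coins → Coins → Set
RightMove d d' = ∃[ k ] ∃[ l ] (k < l × l < length d × at d k ≡ false × at d l ≡ true
                  × d' ≡ trim (set (set d k true) l false))

-- Normal play, short game (every play is finite), so winning is inductive.
data LeftWinsFirst : Coins → Set
data LeftWinsSecond : Coins → Set

data LeftWinsFirst where
  move : ∀ {d d'} → LeftMove d d' → LeftWinsSecond d' → LeftWinsFirst d

data LeftWinsSecond where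
  reply : ∀ {d} → (∀ {d'} → RightMove d d' → LeftWinsFirst d') → LeftWinsSecond d

LeftWins : Coins → Set
LeftWins d = LeftWinsFirst d × LeftWinsSecond d

{-# OPTIONS --safe #-}
-- Trimming and Right moves preserve the number of 1s, while a Left move removes
-- two of them. So from a position with 2n 1s Left can always reply to Right and
-- reach 2(n-1) 1s, and Right, who needs a 1 to move, is the first to get stuck.
-- A leading 1 can never be chosen by Right (its dₖ must be 0), so Left can keep
-- it as a spectator: prepending a 1 preserves her wins. If d = 1ds, either ds
-- has a positive even number of 1s, or d itself has an even number of them.
module Submission where

open import Defs
open import Data.Bool using (true; false)
open import Data.Nat using (ℕ; zero; suc; _*_; _+_; _≤_; _<_; z≤n; s≤s)
open import Data.Nat.Properties using (suc-injective; +-suc; <-trans; <⇒≢)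
open import Data.List using ([]; _∷_; length)
open import Data.Product using (∃-syntax; _×_; _,_)
open import Data.Sum using (_⊎_; inj₁; inj₂)
open import Data.Empty using (⊥-elim)
open import Relation.Binary.PropositionalEquality
  using (_≡_; _≢_; refl; sym; trans; cong; module ≡-Reasoning)
open import Function using (_∘_; case_of_)

2*suc : ∀ n → 2 * suc n ≡ suc (suc (2 * n))
2*suc n = cong suc (+-suc n (n + 0))

even-or-odd : ∀ n → ∃[ k ] (n ≡ 2 * k ⊎ n ≡ suc (2 * k))
even-or-odd zero = 0 , inj₁ refl
even-or-odd (suc n) with even-or-odd n
... | k , inj₁ e = k , inj₂ (cong suc e)
... | k , inj₂ e = suc k , inj₁ (trans (cong suc e) (sym (2*suc k)))

trim-true∷ : ∀ bs → trim (true ∷ bs) ≡ true ∷ trim bs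
trim-true∷ bs with trim bs
... | []     = refl
... | _ ∷ _  = refl

ones-trim : ∀ d → ones (trim d) ≡ ones d
ones-trim [] = refl
ones-trim (b ∷ bs) with trim bs | ones-trim bs
... | [] | eq with b
...   | true  = cong suc eq
...   | false = eq
ones-trim (true ∷ bs)  | _ ∷ _ | eq = cong suc eq
ones-trim (false ∷ bs) | _ ∷ _ | eq = eq

at-set-≢ : ∀ d {i j} b → i ≢ j → at (set d i b) j ≡ at d j
at-set-≢ []      {_}     {_}     _ _  = refl
at-set-≢ (_ ∷ _) {zero}  {zero}  _ i≢j = ⊥-elim (i≢j refl)
at-set-≢ (_ ∷ _) {zero}  {suc _} _ _  = refl
at-set-≢ (_ ∷ _) {suc _} {zero}  _ _  = refl
at-set-≢ (_ ∷ bs) {suc _} {suc _} b i≢j = at-set-≢ bs b (λ e → i≢j (cong suc e))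

ones-set-false : ∀ d {i} → at d i ≡ true → ones d ≡ suc (ones (set d i false))
ones-set-false (true ∷ _)   {zero}  refl = refl
ones-set-false (true ∷ bs)  {suc _} p    = cong suc (ones-set-false bs p)
ones-set-false (false ∷ bs) {suc _} p    = ones-set-false bs p

ones-set-true : ∀ d {i} → at d i ≡ false → i < length d →
                ones (set d i true) ≡ suc (ones d)
ones-set-true (false ∷ _)  {zero}  refl _       = refl
ones-set-true (true ∷ bs)  {suc _} p    (s≤s q) = cong suc (ones-set-true bs p q)
ones-set-true (false ∷ bs) {suc _} p    (s≤s q) = ones-set-true bs p q

ones-RightMove : ∀ {d d'} → RightMove d d' → ones d' ≡ ones d
ones-RightMove {d} (k , l , k<l , l<n , dₖ≡0 , dₗ≡1 , refl) =
  suc-injective (begin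
    suc (ones (trim d⁺⁻))  ≡⟨ cong suc (ones-trim d⁺⁻) ⟩
    suc (ones d⁺⁻)         ≡⟨ sym (ones-set-false d⁺ (trans (at-set-≢ d true (<⇒≢ k<l)) dₗ≡1)) ⟩
    ones d⁺                ≡⟨ ones-set-true d dₖ≡0 (<-trans k<l l<n) ⟩
    suc (ones d)           ∎)
  where
  open ≡-Reasoning
  d⁺ d⁺⁻ : Coins
  d⁺ = set d k true
  d⁺⁻ = set d⁺ l false

ones-LeftMove : ∀ {d d'} → LeftMove d d' → ones d ≡ suc (suc (ones d'))
ones-LeftMove {d} (i , j , i<j , _ , dᵢ≡1 , dⱼ≡1 , refl) = begin
  ones d                     ≡⟨ ones-set-false d dᵢ≡1 ⟩
  suc (ones d⁻)              ≡⟨ cong suc (ones-set-false d⁻ (trans (at-set-≢ d false (<⇒≢ i<j)) dⱼ≡1)) ⟩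
  suc (suc (ones d⁻⁻))       ≡⟨ cong (suc ∘ suc) (sym (ones-trim d⁻⁻)) ⟩
  suc (suc (ones (trim d⁻⁻))) ∎
  where
  open ≡-Reasoning
  d⁻ d⁻⁻ : Coins
  d⁻ = set d i false
  d⁻⁻ = set d⁻ j false

RightMove⇒ones≢0 : ∀ {d d'} → RightMove d d' → ones d ≢ 0
RightMove⇒ones≢0 {d} (_ , _ , _ , _ , _ , dₗ≡1 , _) e
  with () ← trans (sym e) (ones-set-false d dₗ≡1)

index-of-one : ∀ d {n} → ones d ≡ suc n → ∃[ i ] (i < length d × at d i ≡ true)
index-of-one (true ∷ _)  _ = 0 , s≤s z≤n , refl
index-of-one (false ∷ bs) e with i , i<n , dᵢ≡1 ← index-of-one bs e = suc i , s≤s i<n , dᵢ≡1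

LeftMove-exists : ∀ d {n} → ones d ≡ suc (suc n) → ∃[ d' ] LeftMove d d'
LeftMove-exists (true ∷ bs) e
  with j , j<n , dⱼ≡1 ← index-of-one bs (suc-injective e) =
  _ , 0 , suc j , s≤s z≤n , s≤s j<n , refl , dⱼ≡1 , refl
LeftMove-exists (false ∷ bs) e
  with _ , i , j , i<j , j<n , dᵢ≡1 , dⱼ≡1 , refl ← LeftMove-exists bs e =
  _ , suc i , suc j , s≤s i<j , s≤s j<n , dᵢ≡1 , dⱼ≡1 , refl

leftWinsSecond-even : ∀ n d → ones d ≡ 2 * n → LeftWinsSecond d
leftWinsFirst-even : ∀ n d → ones d ≡ 2 * suc n → LeftWinsFirst d

leftWinsSecond-even zero d e = reply (λ rm → ⊥-elim (RightMove⇒ones≢0 {d} rm e))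
leftWinsSecond-even (suc n) d e =
  reply (λ rm → leftWinsFirst-even n _ (trans (ones-RightMove {d} rm) e))

leftWinsFirst-even n d e = case LeftMove-exists d ones≡2+2n of λ where
    (_ , lm) → move lm (leftWinsSecond-even n _
      (suc-injective (suc-injective (trans (sym (ones-LeftMove {d} lm)) ones≡2+2n))))
  where
  ones≡2+2n : ones d ≡ suc (suc (2 * n))
  ones≡2+2n = trans e (2*suc n)

leftWins-even : ∀ n d → ones d ≡ 2 * suc n → LeftWins d
leftWins-even n d e = leftWinsFirst-even n d e , leftWinsSecond-even (suc n) d e

LeftMove-true∷ : ∀ {ds ds'} → LeftMove ds ds' → LeftMove (true ∷ ds) (true ∷ ds')
LeftMove-true∷ {ds} (i , j , i<j , j<n , dᵢ≡1 , dⱼ≡1 , refl) =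
  suc i , suc j , s≤s i<j , s≤s j<n , dᵢ≡1 , dⱼ≡1 ,
  sym (trim-true∷ (set (set ds i false) j false))

RightMove-true∷ : ∀ {ds d'} → RightMove (true ∷ ds) d' →
                  ∃[ ds' ] (RightMove ds ds' × d' ≡ true ∷ ds')
RightMove-true∷ {ds} (suc k , suc l , s≤s k<l , s≤s l<n , dₖ≡0 , dₗ≡1 , refl) =
  _ , (k , l , k<l , l<n , dₖ≡0 , dₗ≡1 , refl) , trim-true∷ (set (set ds k true) l false)

leftWinsFirst-true∷ : ∀ {ds} → LeftWinsFirst ds → LeftWinsFirst (true ∷ ds)
leftWinsSecond-true∷ : ∀ {ds} → LeftWinsSecond ds → LeftWinsSecond (true ∷ ds)

leftWinsFirst-true∷ (move lm w) = move (LeftMove-true∷ lm) (leftWinsSecond-true∷ w)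

leftWinsSecond-true∷ (reply w) = reply λ rm →
  case RightMove-true∷ rm of λ where
    (_ , rm' , refl) → leftWinsFirst-true∷ (w rm')

leftWins-true∷ : ∀ {ds} → LeftWins ds → LeftWins (true ∷ ds)
leftWins-true∷ (first , second) = leftWinsFirst-true∷ first , leftWinsSecond-true∷ second

theorem3p1 : (d : Coins) → IsPosition d →
    ((ones d ≢ 0 × ∃[ k ] ones d ≡ 2 * k) ⊎ (∃[ ds ] d ≡ true ∷ ds × 2 ≤ ones d)) →
    LeftWins d
theorem3p1 d _ (inj₁ (ones≢0 , zero , e)) = ⊥-elim (ones≢0 e)
theorem3p1 d _ (inj₁ (_ , suc n , e))     = leftWins-even n d e
theorem3p1 _ _ (inj₂ (ds , refl , s≤s 1≤ones)) with even-or-odd (ones ds)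
... | zero  , inj₁ e = ⊥-elim (<⇒≢ 1≤ones (sym e))
... | suc n , inj₁ e = leftWins-true∷ (leftWins-even n ds e)
... | n     , inj₂ e = leftWins-even n (true ∷ ds) (trans (cong suc e) (sym (2*suc n)))
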